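{- Every deterministic online algorithm for Online Unit Profit Knapsack that receives, as its only advice, the exact value $a(\sigma)$ before processing $\sigma$ has (asymptotic) competitive ratio at most $\frac{e-1}{e}$.
   Context: Online Unit Profit Knapsack: the input is a sequence $\sigma$ of items with sizes in $(0,1]$, revealed one at a time; an online algorithm must irrevocably accept or reject each item on arrival, without knowledge of future items, and may not accept an item if its size plus the total size of already accepted items exceeds $1$. The profit $\mathrm{Alg}(\sigma)$ is the number of accepted items. $\mathrm{Opt}(\sigma)$ is the maximum possible number of items from $\sigma$ of total size at most $1$, attained by taking as many of the smallest items as possible; $a(\sigma)$ is the average size of the items in this optimal solution. An algorithm is $c$-competitive if there is a constant $b$ with $\mathrm{Alg}(\sigma)\ge c\,\mathrm{Opt}(\sigma)-b$ for all $\sigma$; its competitive ratio is the supremum of all such $c$.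
   Formalization: The item sizes, the advice $a(\sigma)$ and the constants $b$ and $c$ in the definition of $c$-competitiveness are taken in the rationals rather than the reals. -}

module Defs where

open import Data.Nat as ℕ using (ℕ; zero; suc)
open import Data.Integer using (+_)
open import Data.Rational as ℚ using (ℚ; 0ℚ; 1ℚ; _+_; _*_; _-_; _≤_; _<_; _/_; _÷_)
open import Data.Rational.Properties using (≤-decTotalOrder; _≤?_)
open import Data.List using (List; []; _∷_; _++_; [_]; length)
open import Data.List.Relation.Unary.All using (All)
open import Data.Bool using (Bool; true; false; _∧_; if_then_else_)
open import Data.Product using (_×_; ∃)
open import Relation.Nullary.Decidable using (⌊_⌋)
import Data.List.Sort as Sort

_^ℚ_ : ℚ → ℕ → ℚ
q ^ℚ zero  = 1ℚ
q ^ℚ suc n = q * (q ^ℚ n)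

Item-ok : ℚ → Set
Item-ok x = (0ℚ < x) × (x ≤ 1ℚ)

ValidInput : List ℚ → Set
ValidInput σ = All Item-ok σ

sumℚ : List ℚ → ℚ
sumℚ []       = 0ℚ
sumℚ (x ∷ xs) = x + sumℚ xs

sortℚ : List ℚ → List ℚ
sortℚ = Sort.sort ≤-decTotalOrder

prefixFit : ℚ → List ℚ → List ℚ
prefixFit load []       = []
prefixFit load (x ∷ xs) with ⌊ load + x ≤? 1ℚ ⌋
... | true  = x ∷ prefixFit (load + x) xs
... | false = []

optSol : List ℚ → List ℚ
optSol σ = prefixFit 0ℚ (sortℚ σ)

Opt : List ℚ → ℕ
Opt σ = length (optSol σ)

-- a(σ): average size of the items in the optimal solution
-- (convention: 0 when the optimal solution is empty, i.e. σ = []).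
avg : List ℚ → ℚ
avg σ with optSol σ
... | []         = 0ℚ
... | s@(_ ∷ _)  = sumℚ s * (+ 1 / length s)

-- A deterministic online algorithm with advice ℚ: given the advice, the
-- items revealed so far (in order) and the current item, decide
-- accept (true) / reject (false).
OnlineAlg : Set
OnlineAlg = ℚ → List ℚ → ℚ → Bool

-- Running the algorithm: an accept is only executed if the item fits
-- (an infeasible accept is treated as a reject).
run : OnlineAlg → ℚ → List ℚ → ℚ → List ℚ → ℕ
run A adv hist load []       = 0
run A adv hist load (x ∷ xs) with A adv hist x ∧ ⌊ load + x ≤? 1ℚ ⌋
... | true  = suc (run A adv (hist ++ [ x ]) (load + x) xs)
... | false = run A adv (hist ++ [ x ]) load xs

AlgProfit : OnlineAlg → List ℚ → ℕ
AlgProfit A σ = run A (avg σ) [] 0ℚ σ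

toℚ : ℕ → ℚ
toℚ n = + n / 1

Competitive : OnlineAlg → ℚ → Set
Competitive A c = ∃ λ (b : ℚ) → ∀ (σ : List ℚ) → ValidInput σ →
  c * toℚ (Opt σ) - b ≤ toℚ (AlgProfit A σ)

-- c ≤ (e−1)/e, expressed via the upper bounds (1+1/n)^(n+1) ↓ e:
-- (e−1)/e = inf_{n≥1} (1 − (n/(n+1))^(n+1)).
≤1-1/e : ℚ → Set
≤1-1/e c = ∀ (m : ℕ) → c ≤ 1ℚ - ((+ suc m / suc (suc m)) ^ℚ suc (suc m))

-- Fix n ≥ 1 and let e k = n^k (n+1)^(n+1-k), so that e (n+1) / e 0 = (n/(n+1))^(n+1). The
-- adversary presents phases k = 0, 1, …, n+1, phase k consisting of count k items of size
-- (1 + t·e k)/D, and the input σ k stops after phase k, padded with N − count k items of size 1/D.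
-- Sizes decrease from phase to phase and count k · e k does not depend on k, so the optimum of
-- every σ k is the padding together with phase k: it fills the knapsack exactly, Opt (σ k) = N and
-- a(σ k) = 1/N. The advice is thus the same for all σ k, and the online algorithm accepts the same
-- number a j of phase-j items in each of them. Competitiveness on σ k bounds c·N by
-- a 0 + … + a k + (N − count k) + b, while the capacity bounds Σ a j (1 + t·e j) by D. Summing the
-- first family with weights e k − e (k+1) (and e (n+1) for the last phase), i.e. summation by
-- parts, and comparing with the capacity gives c ≤ 1 − (n/(n+1))^(n+1) once t and M are large
-- relative to the denominator of c and to b.

module Submission where

open import Defs
open import Data.Nat using (ℕ; suc; NonZero)
open import Data.Rational using (ℚ)

module Sums where

  open import Data.Nat
  open import Data.Nat.Properties
  open import Data.List using ([]; _∷_)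
  open import Data.Nat.Tactic.RingSolver using (solve)
  open import Relation.Binary.PropositionalEquality
  open ≡-Reasoning

  ∑ : ℕ → (ℕ → ℕ) → ℕ
  ∑ zero    f = 0
  ∑ (suc n) f = ∑ n f + f n

  infix 5 ∑
  syntax ∑ n (λ k → x) = ∑[ k < n ] x

  ∑-cong : ∀ {n f g} → (∀ {k} → k < n → f k ≡ g k) → ∑ n f ≡ ∑ n g
  ∑-cong {zero}  f≡g = refl
  ∑-cong {suc n} f≡g = cong₂ _+_ (∑-cong (λ k<n → f≡g (m<n⇒m<1+n k<n))) (f≡g ≤-refl)

  ∑-mono-≤ : ∀ {n f g} → (∀ {k} → k < n → f k ≤ g k) → ∑ n f ≤ ∑ n g
  ∑-mono-≤ {zero}  f≤g = z≤n
  ∑-mono-≤ {suc n} f≤g = +-mono-≤ (∑-mono-≤ (λ k<n → f≤g (m<n⇒m<1+n k<n))) (f≤g ≤-refl)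

  ∑-distrib-+ : ∀ n f g → (∑[ k < n ] (f k + g k)) ≡ ∑ n f + ∑ n g
  ∑-distrib-+ zero    f g = refl
  ∑-distrib-+ (suc n) f g = begin
    (∑[ k < n ] (f k + g k)) + (f n + g n) ≡⟨ cong (_+ (f n + g n)) (∑-distrib-+ n f g) ⟩
    (∑ n f + ∑ n g) + (f n + g n)          ≡⟨ +-interchange (∑ n f) (∑ n g) (f n) (g n) ⟩
    (∑ n f + f n) + (∑ n g + g n)          ∎
    where
    +-interchange : ∀ a b c d → (a + b) + (c + d) ≡ (a + c) + (b + d)
    +-interchange a b c d = solve (a ∷ b ∷ c ∷ d ∷ [])

  *-distribˡ-∑ : ∀ c n f → c * ∑ n f ≡ (∑[ k < n ] c * f k)
  *-distribˡ-∑ c zero    f = *-zeroʳ c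
  *-distribˡ-∑ c (suc n) f =
    trans (*-distribˡ-+ c (∑ n f) (f n)) (cong (_+ c * f n) (*-distribˡ-∑ c n f))

  ∑-const : ∀ n c → (∑[ k < n ] c) ≡ n * c
  ∑-const zero    c = refl
  ∑-const (suc n) c = trans (cong (_+ c) (∑-const n c)) (+-comm (n * c) c)

  module _ {e w : ℕ → ℕ} where

    ∑-telescope : ∀ n → (∀ {k} → k < n → e k ≡ w k + e (suc k)) → e n + ∑ n w ≡ e 0
    ∑-telescope zero    e-step = +-identityʳ (e 0)
    ∑-telescope (suc n) e-step = begin
      e (suc n) + (∑ n w + w n) ≡⟨ rearrange (e (suc n)) (∑ n w) (w n) ⟩
      (w n + e (suc n)) + ∑ n w ≡⟨ cong (_+ ∑ n w) (e-step ≤-refl) ⟨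
      e n + ∑ n w               ≡⟨ ∑-telescope n (λ k<n → e-step (m<n⇒m<1+n k<n)) ⟩
      e 0                       ∎
      where
      rearrange : ∀ a b c → a + (b + c) ≡ (c + a) + b
      rearrange a b c = solve (a ∷ b ∷ c ∷ [])

    ∑-by-parts : ∀ (a : ℕ → ℕ) n → (∀ {k} → k < n → e k ≡ w k + e (suc k)) →
      e n * (∑[ j < suc n ] a j) + (∑[ k < n ] w k * (∑[ j < suc k ] a j)) ≡ (∑[ j < suc n ] a j * e j)
    ∑-by-parts a zero    e-step = trans (+-identityʳ (e 0 * a 0)) (*-comm (e 0) (a 0))
    ∑-by-parts a (suc n) e-step = begin
      e (suc n) * (A n + a (suc n)) + (P + w n * A n)
        ≡⟨ rearrange (e (suc n)) (A n) (a (suc n)) P (w n) ⟩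
      (w n + e (suc n)) * A n + P + a (suc n) * e (suc n)
        ≡⟨ cong (λ x → x * A n + P + a (suc n) * e (suc n)) (e-step ≤-refl) ⟨
      e n * A n + P + a (suc n) * e (suc n)
        ≡⟨ cong (_+ a (suc n) * e (suc n)) (∑-by-parts a n (λ k<n → e-step (m<n⇒m<1+n k<n))) ⟩
      (∑[ j < suc n ] a j * e j) + a (suc n) * e (suc n) ∎
      where
      A : ℕ → ℕ
      A k = ∑[ j < suc k ] a j
      P : ℕ
      P = ∑[ k < n ] w k * A k
      rearrange : ∀ x y z u v → x * (y + z) + (u + v * y) ≡ (v + x) * y + u + z * x
      rearrange x y z u v = solve (x ∷ y ∷ z ∷ u ∷ v ∷ [])

  module Weighted (e w : ℕ → ℕ) (n : ℕ) (e-step : ∀ {k} → k < n → e k ≡ w k + e (suc k)) where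

    W : (ℕ → ℕ) → ℕ
    W f = e n * f n + (∑[ k < n ] w k * f k)

    W-mono-≤ : ∀ {f g} → (∀ {k} → k ≤ n → f k ≤ g k) → W f ≤ W g
    W-mono-≤ f≤g = +-mono-≤ (*-monoʳ-≤ (e n) (f≤g ≤-refl)) (∑-mono-≤ (λ k<n → *-monoʳ-≤ (w _) (f≤g (<⇒≤ k<n))))

    W-affine : ∀ y c f → W (λ k → y + c * f k) ≡ y * e 0 + c * W f
    W-affine y c f = begin
      e n * (y + c * f n) + (∑[ k < n ] w k * (y + c * f k))
        ≡⟨ cong (e n * (y + c * f n) +_) (∑-cong {n} (λ {k} _ → distrib (w k) (f k))) ⟩
      e n * (y + c * f n) + (∑[ k < n ] (y * w k + c * (w k * f k)))
        ≡⟨ cong (e n * (y + c * f n) +_) (∑-distrib-+ n (λ k → y * w k) (λ k → c * (w k * f k))) ⟩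
      e n * (y + c * f n) + ((∑[ k < n ] y * w k) + (∑[ k < n ] c * (w k * f k)))
        ≡⟨ cong₂ (λ u v → e n * (y + c * f n) + (u + v)) (*-distribˡ-∑ y n w) (*-distribˡ-∑ c n _) ⟨
      e n * (y + c * f n) + (y * ∑ n w + c * (∑[ k < n ] w k * f k))
        ≡⟨ regroup (e n) (f n) (∑ n w) (∑[ k < n ] w k * f k) ⟩
      y * (e n + ∑ n w) + c * W f
        ≡⟨ cong (λ x → y * x + c * W f) (∑-telescope n e-step) ⟩
      y * e 0 + c * W f ∎
      where
      distrib : ∀ u v → u * (y + c * v) ≡ y * u + c * (u * v)
      distrib u v = solve (u ∷ v ∷ y ∷ c ∷ [])
      regroup : ∀ u v s t → u * (y + c * v) + (y * s + c * t) ≡ y * (u + s) + c * (u * v + t)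
      regroup u v s t = solve (u ∷ v ∷ s ∷ t ∷ y ∷ c ∷ [])

    W-prefix-sums : ∀ a → W (λ k → ∑[ j < suc k ] a j) ≡ (∑[ j < suc n ] a j * e j)
    W-prefix-sums a = ∑-by-parts a n e-step

open Sums

module Weights (n M : ℕ) where

  open import Data.Nat
  open import Data.Nat.Properties
  open import Data.Nat.Tactic.RingSolver using (solve-∀)
  open import Relation.Binary.PropositionalEquality
  open ≤-Reasoning

  X Z N E : ℕ
  X = suc n ^ suc n
  Z = n ^ suc n
  N = X * M
  E = Z * N

  e w count : ℕ → ℕ
  e k     = n ^ k * suc n ^ (suc n ∸ k)
  w k     = n ^ k * suc n ^ (n ∸ k)
  count k = n ^ (suc n ∸ k) * suc n ^ k * M

  private
    ^-split : ∀ x {k m} → k ≤ m → x ^ k * x ^ (m ∸ k) ≡ x ^ m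
    ^-split x {k} k≤m = trans (sym (^-distribˡ-+-* x k _)) (cong (x ^_) (m+[n∸m]≡n k≤m))

  e-step : ∀ {k} → k < suc n → e k ≡ w k + e (suc k)
  e-step {k} (s≤s k≤n) = begin-equality
    n ^ k * suc n ^ (suc n ∸ k)                               ≡⟨ cong (λ j → n ^ k * suc n ^ j) (+-∸-assoc 1 k≤n) ⟩
    n ^ k * ((1 + n) * suc n ^ (n ∸ k))                        ≡⟨ distrib n (n ^ k) (suc n ^ (n ∸ k)) ⟩
    n ^ k * suc n ^ (n ∸ k) + n * n ^ k * suc n ^ (n ∸ k)      ∎
    where
    distrib : ∀ n x y → x * ((1 + n) * y) ≡ x * y + n * x * y
    distrib = solve-∀

  e-0 : e 0 ≡ X
  e-0 = +-identityʳ X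

  e-antitone : ∀ {k} → k < suc n → e (suc k) ≤ e k
  e-antitone {k} k<1+n = subst (e (suc k) ≤_) (sym (e-step k<1+n)) (m≤n+m (e (suc k)) (w k))

  count*e≡E : ∀ {k} → k ≤ suc n → count k * e k ≡ E
  count*e≡E {k} k≤1+n = begin-equality
    n ^ (suc n ∸ k) * suc n ^ k * M * (n ^ k * suc n ^ (suc n ∸ k))     ≡⟨ regroup (n ^ (suc n ∸ k)) (suc n ^ k) (n ^ k) (suc n ^ (suc n ∸ k)) M ⟩
    (n ^ k * n ^ (suc n ∸ k)) * (suc n ^ k * suc n ^ (suc n ∸ k) * M)   ≡⟨ cong₂ (λ u v → u * (v * M)) (^-split n k≤1+n) (^-split (suc n) k≤1+n) ⟩
    Z * N                                                               ∎
    where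
    regroup : ∀ a b c d M → a * b * M * (c * d) ≡ (c * a) * (b * d * M)
    regroup = solve-∀

  w*count : ∀ {k} → k ≤ n → w k * count k ≡ Z * (suc n ^ n * M)
  w*count {k} k≤n = begin-equality
    n ^ k * suc n ^ (n ∸ k) * (n ^ (suc n ∸ k) * suc n ^ k * M)        ≡⟨ regroup (n ^ k) (suc n ^ (n ∸ k)) (n ^ (suc n ∸ k)) (suc n ^ k) M ⟩
    (n ^ k * n ^ (suc n ∸ k)) * (suc n ^ k * suc n ^ (n ∸ k) * M)      ≡⟨ cong₂ (λ u v → u * (v * M)) (^-split n (m≤n⇒m≤1+n k≤n)) (^-split (suc n) k≤n) ⟩
    Z * (suc n ^ n * M)                                                 ∎
    where
    regroup : ∀ a b c d M → a * b * (c * d * M) ≡ (a * c) * (d * b * M)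
    regroup = solve-∀

  count≤N : ∀ {k} → k ≤ suc n → count k ≤ N
  count≤N {k} k≤1+n = begin
    n ^ (suc n ∸ k) * suc n ^ k * M       ≤⟨ *-monoˡ-≤ M (*-monoˡ-≤ (suc n ^ k) (^-monoˡ-≤ (suc n ∸ k) (n≤1+n n))) ⟩
    suc n ^ (suc n ∸ k) * suc n ^ k * M   ≡⟨ cong (_* M) (trans (*-comm (suc n ^ (suc n ∸ k)) _) (^-split (suc n) k≤1+n)) ⟩
    N                                     ∎

  open Weighted e w (suc n) e-step public

  W-count : W count ≡ E + E
  W-count = cong₂ _+_ (trans (*-comm (e (suc n)) _) (count*e≡E ≤-refl)) (begin-equality
    (∑[ k < suc n ] w k * count k)            ≡⟨ ∑-cong (λ k<1+n → w*count (s≤s⁻¹ k<1+n)) ⟩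
    (∑[ k < suc n ] Z * (suc n ^ n * M))      ≡⟨ ∑-const (suc n) _ ⟩
    suc n * (Z * (suc n ^ n * M))             ≡⟨ regroup (suc n) Z (suc n ^ n) M ⟩
    Z * (suc n * suc n ^ n * M)               ∎)
    where
    regroup : ∀ a b c d → a * (b * (c * d)) ≡ b * (a * c * d)
    regroup = solve-∀

module ScaledNaturals where

  open import Data.Nat as ℕ using (zero; suc; NonZero)
  import Data.Nat.Properties as ℕ
  open import Data.Integer as ℤ using (+_)
  import Data.Integer.Properties as ℤ
  open import Data.Integer.Tactic.RingSolver using (solve-∀)
  open import Data.Rational using (ℚ; 0ℚ; 1ℚ; _+_; _*_; _≤_; _<_; _/_; toℚᵘ; NonNegative; Positive)
  open import Data.Rational.Properties
  import Data.Rational.Unnormalised as ℚᵘ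
  import Data.Rational.Unnormalised.Properties as ℚᵘ
  open import Data.Rational.Solver using (module +-*-Solver)
  open import Relation.Binary.PropositionalEquality

  p≤p+q : ∀ p {q} → 0ℚ ≤ q → p ≤ p + q
  p≤p+q p {q} 0≤q = subst (_≤ p + q) (+-identityʳ p) (+-monoʳ-≤ p 0≤q)

  p<p+q : ∀ p {q} → 0ℚ < q → p < p + q
  p<p+q p {q} 0<q = subst (_< p + q) (+-identityʳ p) (+-monoʳ-< p 0<q)

  infixl 7 _/ℕ_

  -- Opaque because unfolding + a / D exposes gcd normalisation, which unification would
  -- otherwise try to evaluate on symbolic denominators.
  opaque

    _/ℕ_ : ℕ → (D : ℕ) → .{{NonZero D}} → ℚ
    a /ℕ D = + a / D

    /ℕ≡/ : ∀ a D .{{_ : NonZero D}} → a /ℕ D ≡ + a / D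
    /ℕ≡/ a D = refl

    /ℕ-nonNeg : ∀ a D .{{_ : NonZero D}} → NonNegative (a /ℕ D)
    /ℕ-nonNeg a D = normalize-nonNeg a D

    /ℕ-pos : ∀ a D .{{_ : NonZero D}} .{{_ : NonZero a}} → Positive (a /ℕ D)
    /ℕ-pos a D = normalize-pos a D

    toℚᵘ-/ℕ : ∀ a D .{{_ : NonZero D}} → toℚᵘ (a /ℕ D) ℚᵘ.≃ + a ℚᵘ./ D
    toℚᵘ-/ℕ a (suc D-1) = toℚᵘ-fromℚᵘ (ℚᵘ.mkℚᵘ (+ a) D-1)

    /ℕ-homo-+ : ∀ D .{{_ : NonZero D}} a b → (a ℕ.+ b) /ℕ D ≡ a /ℕ D + b /ℕ D
    /ℕ-homo-+ D@(suc _) a b = toℚᵘ-injective (begin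
      toℚᵘ ((a ℕ.+ b) /ℕ D)             ≈⟨ toℚᵘ-/ℕ (a ℕ.+ b) D ⟩
      + (a ℕ.+ b) ℚᵘ./ D                ≈⟨ ℚᵘ.*≡* cross-multiplied ⟩
      + a ℚᵘ./ D ℚᵘ.+ + b ℚᵘ./ D        ≈⟨ ℚᵘ.+-cong (toℚᵘ-/ℕ a D) (toℚᵘ-/ℕ b D) ⟨
      toℚᵘ (a /ℕ D) ℚᵘ.+ toℚᵘ (b /ℕ D)  ≈⟨ toℚᵘ-homo-+ (a /ℕ D) (b /ℕ D) ⟨
      toℚᵘ (a /ℕ D + b /ℕ D)            ∎)
      where
      open ℚᵘ.≃-Reasoning
      distrib : ∀ x y z → (x ℤ.+ y) ℤ.* (z ℤ.* z) ≡ (x ℤ.* z ℤ.+ y ℤ.* z) ℤ.* z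
      distrib = solve-∀
      cross-multiplied : + (a ℕ.+ b) ℤ.* + (D ℕ.* D) ≡ (+ a ℤ.* + D ℤ.+ + b ℤ.* + D) ℤ.* + D
      cross-multiplied = trans (cong₂ ℤ._*_ (ℤ.pos-+ a b) (ℤ.pos-* D D)) (distrib (+ a) (+ b) (+ D))

    D/D≡1 : ∀ D .{{_ : NonZero D}} → D /ℕ D ≡ 1ℚ
    D/D≡1 D@(suc _) = toℚᵘ-injective (ℚᵘ.≃-trans (toℚᵘ-/ℕ D D) (ℚᵘ.*≡* (ℤ.*-comm (+ D) (+ 1))))

    0/D≡0 : ∀ D .{{_ : NonZero D}} → 0 /ℕ D ≡ 0ℚ
    0/D≡0 D@(suc _) = toℚᵘ-injective (ℚᵘ.≃-trans (toℚᵘ-/ℕ 0 D) (ℚᵘ.*≡* refl))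

    a/D*D≡a : ∀ D .{{_ : NonZero D}} a → a /ℕ D * toℚ D ≡ toℚ a
    a/D*D≡a D@(suc _) a = toℚᵘ-injective (begin
      toℚᵘ (a /ℕ D * toℚ D)             ≈⟨ toℚᵘ-homo-* (a /ℕ D) (toℚ D) ⟩
      toℚᵘ (a /ℕ D) ℚᵘ.* toℚᵘ (toℚ D)   ≈⟨ ℚᵘ.*-cong (toℚᵘ-/ℕ a D) (toℚᵘ-/ℕ D 1) ⟩
      (+ a ℚᵘ./ D) ℚᵘ.* (+ D ℚᵘ./ 1)    ≈⟨ ℚᵘ.*≡* cross-multiplied ⟩
      + a ℚᵘ./ 1                        ≈⟨ toℚᵘ-/ℕ a 1 ⟨
      toℚᵘ (toℚ a)                      ∎)
      where
      open ℚᵘ.≃-Reasoning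
      assoc : ∀ x y → (x ℤ.* y) ℤ.* + 1 ≡ x ℤ.* (y ℤ.* + 1)
      assoc = solve-∀
      cross-multiplied : (+ a ℤ.* + D) ℤ.* + 1 ≡ + a ℤ.* + (D ℕ.* 1)
      cross-multiplied = trans (assoc (+ a) (+ D)) (cong (+ a ℤ.*_) (sym (ℤ.pos-* D 1)))

    toℚ-homo-* : ∀ a b → toℚ (a ℕ.* b) ≡ toℚ a * toℚ b
    toℚ-homo-* a b = toℚᵘ-injective (begin
      toℚᵘ (toℚ (a ℕ.* b))              ≈⟨ toℚᵘ-/ℕ (a ℕ.* b) 1 ⟩
      + (a ℕ.* b) ℚᵘ./ 1                ≈⟨ ℚᵘ.*≡* (cong (ℤ._* + 1) (ℤ.pos-* a b)) ⟩
      (+ a ℚᵘ./ 1) ℚᵘ.* (+ b ℚᵘ./ 1)    ≈⟨ ℚᵘ.*-cong (toℚᵘ-/ℕ a 1) (toℚᵘ-/ℕ b 1) ⟨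
      toℚᵘ (toℚ a) ℚᵘ.* toℚᵘ (toℚ b)    ≈⟨ toℚᵘ-homo-* (toℚ a) (toℚ b) ⟨
      toℚᵘ (toℚ a * toℚ b)              ∎)
      where open ℚᵘ.≃-Reasoning

  module _ (D : ℕ) .{{_ : NonZero D}} where

    /ℕ-mono-≤ : ∀ {a b} → a ℕ.≤ b → a /ℕ D ≤ b /ℕ D
    /ℕ-mono-≤ {a} {b} a≤b = begin
      a /ℕ D                      ≤⟨ p≤p+q (a /ℕ D) (nonNegative⁻¹ _ {{/ℕ-nonNeg (b ℕ.∸ a) D}}) ⟩
      a /ℕ D + (b ℕ.∸ a) /ℕ D     ≡⟨ /ℕ-homo-+ D a (b ℕ.∸ a) ⟨
      (a ℕ.+ (b ℕ.∸ a)) /ℕ D      ≡⟨ cong (λ c → c /ℕ D) (ℕ.m+[n∸m]≡n a≤b) ⟩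
      b /ℕ D                      ∎
      where open ≤-Reasoning

    /ℕ-mono-< : ∀ {a b} → a ℕ.< b → a /ℕ D < b /ℕ D
    /ℕ-mono-< {a} {b} a<b = begin-strict
      a /ℕ D                      <⟨ p<p+q (a /ℕ D) (positive⁻¹ _ {{/ℕ-pos (b ℕ.∸ a) D}}) ⟩
      a /ℕ D + (b ℕ.∸ a) /ℕ D     ≡⟨ /ℕ-homo-+ D a (b ℕ.∸ a) ⟨
      (a ℕ.+ (b ℕ.∸ a)) /ℕ D      ≡⟨ cong (λ c → c /ℕ D) (ℕ.m+[n∸m]≡n (ℕ.<⇒≤ a<b)) ⟩
      b /ℕ D                      ∎
      where
      open ≤-Reasoning
      instance
        b-a≢0 : NonZero (b ℕ.∸ a)
        b-a≢0 = ℕ.>-nonZero (ℕ.m<n⇒0<n∸m a<b)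

    /ℕ-cancel-≤ : ∀ {a b} → a /ℕ D ≤ b /ℕ D → a ℕ.≤ b
    /ℕ-cancel-≤ a/D≤b/D = ℕ.≮⇒≥ (λ b<a → <-irrefl refl (<-≤-trans (/ℕ-mono-< b<a) a/D≤b/D))

  opaque
    unfolding _/ℕ_

    toℚ-homo-+ : ∀ a b → toℚ (a ℕ.+ b) ≡ toℚ a + toℚ b
    toℚ-homo-+ = /ℕ-homo-+ 1

    toℚ-mono-≤ : ∀ {a b} → a ℕ.≤ b → toℚ a ≤ toℚ b
    toℚ-mono-≤ = /ℕ-mono-≤ 1

    toℚ-cancel-≤ : ∀ {a b} → toℚ a ≤ toℚ b → a ℕ.≤ b
    toℚ-cancel-≤ = /ℕ-cancel-≤ 1

  [a/D]^k*D^k≡a^k : ∀ D .{{_ : NonZero D}} a k → (a /ℕ D) ^ℚ k * toℚ (D ℕ.^ k) ≡ toℚ (a ℕ.^ k)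
  [a/D]^k*D^k≡a^k D a zero    = *-identityˡ 1ℚ
  [a/D]^k*D^k≡a^k D a (suc k) = begin
    (a /ℕ D * (a /ℕ D) ^ℚ k) * toℚ (D ℕ.* D ℕ.^ k)       ≡⟨ cong (a /ℕ D * (a /ℕ D) ^ℚ k *_) (toℚ-homo-* D (D ℕ.^ k)) ⟩
    (a /ℕ D * (a /ℕ D) ^ℚ k) * (toℚ D * toℚ (D ℕ.^ k))   ≡⟨ interchange (a /ℕ D) ((a /ℕ D) ^ℚ k) (toℚ D) (toℚ (D ℕ.^ k)) ⟩
    (a /ℕ D * toℚ D) * ((a /ℕ D) ^ℚ k * toℚ (D ℕ.^ k))   ≡⟨ cong₂ _*_ (a/D*D≡a D a) ([a/D]^k*D^k≡a^k D a k) ⟩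
    toℚ a * toℚ (a ℕ.^ k)                                ≡⟨ toℚ-homo-* a (a ℕ.^ k) ⟨
    toℚ (a ℕ.* a ℕ.^ k)                                  ∎
    where
    open ≡-Reasoning
    open +-*-Solver
    interchange : ∀ w x y z → (w * x) * (y * z) ≡ (w * y) * (x * z)
    interchange = solve 4 (λ w x y z → (w :* x) :* (y :* z) := (w :* y) :* (x :* z)) refl

open ScaledNaturals

module Optimum where

  open import Data.Nat as ℕ using (zero; suc; NonZero)
  import Data.Nat.Properties as ℕ
  import Data.Integer as ℤ
  open import Data.Rational using (0ℚ; 1ℚ; _+_; _*_; _≤_; _<_; _/_)
  open import Data.Rational.Properties
  open import Data.List using ([]; _∷_; _++_; replicate; length)
  open import Data.List.Relation.Unary.All using (All; []; _∷_)
  open import Data.List.Relation.Unary.Linked using ([-]; _∷_)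
  open import Data.List.Relation.Binary.Permutation.Propositional using (_↭_; ↭⇒↭ₛ)
    renaming (↭-trans to ↭-trans′)
  open import Data.List.Relation.Binary.Pointwise using (Pointwise-≡⇒≡)
  open import Data.List.Relation.Unary.Sorted.TotalOrder.Properties using (↗↭↗⇒≋)
  open import Relation.Binary.Bundles using (DecTotalOrder)
  open import Relation.Nullary.Decidable using (yes; no)
  open import Data.Empty using (⊥-elim)
  open import Relation.Binary.PropositionalEquality
  import Data.List.Sort ≤-decTotalOrder as Sort

  open import Data.List.Relation.Unary.Sorted.TotalOrder (DecTotalOrder.totalOrder ≤-decTotalOrder) public
    using (Sorted)

  sumℚ-++ : ∀ xs ys → sumℚ (xs ++ ys) ≡ sumℚ xs + sumℚ ys
  sumℚ-++ []       ys = sym (+-identityˡ (sumℚ ys))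
  sumℚ-++ (x ∷ xs) ys = trans (cong (x +_) (sumℚ-++ xs ys)) (sym (+-assoc x (sumℚ xs) (sumℚ ys)))

  sumℚ-replicate : ∀ D .{{_ : NonZero D}} r s → sumℚ (replicate r (s /ℕ D)) ≡ (r ℕ.* s) /ℕ D
  sumℚ-replicate D zero    s = sym (0/D≡0 D)
  sumℚ-replicate D (suc r) s = trans (cong (s /ℕ D +_) (sumℚ-replicate D r s)) (sym (/ℕ-homo-+ D s (r ℕ.* s)))

  sumℚ-nonNeg : ∀ {xs} → All (0ℚ ≤_) xs → 0ℚ ≤ sumℚ xs
  sumℚ-nonNeg []             = ≤-refl
  sumℚ-nonNeg {x ∷ xs} (0≤x ∷ 0≤xs) = subst (_≤ x + sumℚ xs) (+-identityʳ 0ℚ) (+-mono-≤ 0≤x (sumℚ-nonNeg 0≤xs))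

  prefixFit-++ : ∀ {load xs} ys → All (0ℚ ≤_) xs → load + sumℚ xs ≤ 1ℚ →
    prefixFit load (xs ++ ys) ≡ xs ++ prefixFit (load + sumℚ xs) ys
  prefixFit-++ {load} {[]}     ys []            _    = cong (λ l → prefixFit l ys) (sym (+-identityʳ load))
  prefixFit-++ {load} {x ∷ xs} ys (_ ∷ 0≤xs) fits
    with load + x ≤? 1ℚ | subst (_≤ 1ℚ) (sym (+-assoc load x (sumℚ xs))) fits
  ... | no x-does-not-fit | fits′ = ⊥-elim (x-does-not-fit (≤-trans (p≤p+q (load + x) (sumℚ-nonNeg 0≤xs)) fits′))
  ... | yes _             | fits′ = cong (x ∷_)
    (trans (prefixFit-++ ys 0≤xs fits′) (cong (λ l → xs ++ prefixFit l ys) (+-assoc load x (sumℚ xs))))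

  prefixFit-full : ∀ {xs} → All (0ℚ <_) xs → prefixFit 1ℚ xs ≡ []
  prefixFit-full []        = refl
  prefixFit-full {x ∷ _} (0<x ∷ _) with 1ℚ + x ≤? 1ℚ
  ... | no _      = refl
  ... | yes 1+x≤1 = ⊥-elim (<-irrefl refl (<-≤-trans (p<p+q 1ℚ 0<x) 1+x≤1))

  replicate-↗ : ∀ {x ys} r → Sorted (x ∷ ys) → Sorted (x ∷ replicate r x ++ ys)
  replicate-↗ zero    x∷ys↗ = x∷ys↗
  replicate-↗ (suc r) x∷ys↗ = ≤-refl ∷ replicate-↗ r x∷ys↗

  ↗-lower-head : ∀ {x y ys} → x ≤ y → Sorted (y ∷ ys) → Sorted (x ∷ ys)
  ↗-lower-head x≤y [-]         = [-]
  ↗-lower-head x≤y (y≤z ∷ ys↗) = ≤-trans x≤y y≤z ∷ ys↗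

  sortℚ-unique : ∀ {xs ys} → Sorted ys → xs ↭ ys → sortℚ xs ≡ ys
  sortℚ-unique {xs} {ys} ys↗ xs↭ys = Pointwise-≡⇒≡ (↗↭↗⇒≋ (DecTotalOrder.totalOrder ≤-decTotalOrder)
    (Sort.sort-↗ xs) ys↗ (↭⇒↭ₛ (↭-trans′ (Sort.sort-↭ xs) xs↭ys)))

  avg-cong : ∀ σ σ′ → length (optSol σ) ≡ length (optSol σ′) → sumℚ (optSol σ) ≡ sumℚ (optSol σ′) → avg σ ≡ avg σ′
  avg-cong σ σ′ with optSol σ | optSol σ′
  ... | []    | []    = λ _ _ → refl
  ... | _ ∷ _ | _ ∷ _ = λ |s|≡|s′| ∑s≡∑s′ → cong₂ (λ t l → t * (ℤ.+ 1 / suc l)) ∑s≡∑s′ (ℕ.suc-injective |s|≡|s′|)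
  ... | []    | _ ∷ _ = λ ()
  ... | _ ∷ _ | []    = λ ()

open Optimum

module Runs (A : OnlineAlg) (adv : ℚ) where

  open import Data.Nat using (zero; suc; _+_; _*_; _≤_; z≤n; s≤s)
  open import Data.Nat.Properties using (+-identityʳ; +-assoc; m≤n⇒m≤1+n)
  import Data.Rational as ℚ
  import Data.Rational.Properties as ℚ
  open import Data.Bool using (true; false; _∧_)
  open import Data.List using (List; []; _∷_; _++_; [_]; length; replicate)
  import Data.List.Properties as List
  open import Relation.Nullary.Decidable using (⌊_⌋; yes; no)
  open import Relation.Binary.PropositionalEquality hiding ([_])
  open ≡-Reasoning

  loadAfter : List ℚ → ℚ → List ℚ → ℚ
  loadAfter hist load []       = load
  loadAfter hist load (x ∷ xs) with A adv hist x ∧ ⌊ load ℚ.+ x ℚ.≤? ℚ.1ℚ ⌋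
  ... | true  = loadAfter (hist ++ [ x ]) (load ℚ.+ x) xs
  ... | false = loadAfter (hist ++ [ x ]) load xs

  run-++ : ∀ hist load xs ys →
    run A adv hist load (xs ++ ys) ≡ run A adv hist load xs + run A adv (hist ++ xs) (loadAfter hist load xs) ys
  run-++ hist load []       ys = cong (λ h → run A adv h load ys) (sym (List.++-identityʳ hist))
  run-++ hist load (x ∷ xs) ys with A adv hist x ∧ ⌊ load ℚ.+ x ℚ.≤? ℚ.1ℚ ⌋
  ... | true  rewrite run-++ (hist ++ [ x ]) (load ℚ.+ x) xs ys | List.++-assoc hist [ x ] xs = refl
  ... | false rewrite run-++ (hist ++ [ x ]) load xs ys | List.++-assoc hist [ x ] xs = refl

  loadAfter-++ : ∀ hist load xs ys →
    loadAfter hist load (xs ++ ys) ≡ loadAfter (hist ++ xs) (loadAfter hist load xs) ys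
  loadAfter-++ hist load []       ys = cong (λ h → loadAfter h load ys) (sym (List.++-identityʳ hist))
  loadAfter-++ hist load (x ∷ xs) ys with A adv hist x ∧ ⌊ load ℚ.+ x ℚ.≤? ℚ.1ℚ ⌋
  ... | true  rewrite loadAfter-++ (hist ++ [ x ]) (load ℚ.+ x) xs ys | List.++-assoc hist [ x ] xs = refl
  ... | false rewrite loadAfter-++ (hist ++ [ x ]) load xs ys | List.++-assoc hist [ x ] xs = refl

  run≤length : ∀ hist load xs → run A adv hist load xs ≤ length xs
  run≤length hist load []       = z≤n
  run≤length hist load (x ∷ xs) with A adv hist x ∧ ⌊ load ℚ.+ x ℚ.≤? ℚ.1ℚ ⌋
  ... | true  = s≤s (run≤length (hist ++ [ x ]) (load ℚ.+ x) xs)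
  ... | false = m≤n⇒m≤1+n (run≤length (hist ++ [ x ]) load xs)

  loadAfter-≤1 : ∀ hist {load} xs → load ℚ.≤ ℚ.1ℚ → loadAfter hist load xs ℚ.≤ ℚ.1ℚ
  loadAfter-≤1 hist        []       load≤1 = load≤1
  loadAfter-≤1 hist {load} (x ∷ xs) load≤1 with A adv hist x | load ℚ.+ x ℚ.≤? ℚ.1ℚ
  ... | true  | yes fits = loadAfter-≤1 (hist ++ [ x ]) xs fits
  ... | true  | no _     = loadAfter-≤1 (hist ++ [ x ]) xs load≤1
  ... | false | _        = loadAfter-≤1 (hist ++ [ x ]) xs load≤1

  module _ (⟦_⟧ : ℕ → ℚ) (⟦⟧-homo-+ : ∀ a b → ⟦ a + b ⟧ ≡ ⟦ a ⟧ ℚ.+ ⟦ b ⟧) where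

    loadAfter-replicate : ∀ hist {load} L r s → load ≡ ⟦ L ⟧ →
      loadAfter hist load (replicate r ⟦ s ⟧) ≡ ⟦ L + run A adv hist load (replicate r ⟦ s ⟧) * s ⟧
    loadAfter-replicate hist L zero    s refl = cong ⟦_⟧ (sym (+-identityʳ L))
    loadAfter-replicate hist L (suc r) s refl with A adv hist ⟦ s ⟧ ∧ ⌊ ⟦ L ⟧ ℚ.+ ⟦ s ⟧ ℚ.≤? ℚ.1ℚ ⌋
    ... | true  = begin
      loadAfter (hist ++ [ ⟦ s ⟧ ]) (⟦ L ⟧ ℚ.+ ⟦ s ⟧) (replicate r ⟦ s ⟧)  ≡⟨ loadAfter-replicate _ (L + s) r s (sym (⟦⟧-homo-+ L s)) ⟩
      ⟦ L + s + accepted * s ⟧                                             ≡⟨ cong ⟦_⟧ (+-assoc L s (accepted * s)) ⟩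
      ⟦ L + (s + accepted * s) ⟧                                           ∎
      where
      accepted : ℕ
      accepted = run A adv (hist ++ [ ⟦ s ⟧ ]) (⟦ L ⟧ ℚ.+ ⟦ s ⟧) (replicate r ⟦ s ⟧)
    ... | false = loadAfter-replicate (hist ++ [ ⟦ s ⟧ ]) L r s refl

module Adversary (Alg : OnlineAlg) (n t M : ℕ) .{{_ : NonZero n}} .{{_ : NonZero M}} where

  open import Data.Nat
  open import Data.Nat.Properties
  open import Data.Nat.Tactic.RingSolver using (solve-∀)
  import Data.Rational as ℚ
  import Data.Rational.Properties as ℚ
  open import Data.List using (List; []; _∷_; _++_; length; replicate)
  import Data.List.Properties as List
  open import Data.List.Relation.Unary.All as All using ([])
  import Data.List.Relation.Unary.All.Properties as All
  import Data.List.Relation.Unary.Linked as Linked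
  open import Data.List.Relation.Binary.Permutation.Propositional using (_↭_; ↭-refl; ↭-trans)
  open import Data.List.Relation.Binary.Permutation.Propositional.Properties using (++-comm; ++⁺ˡ; All-resp-↭)
  open import Data.Product using (_,_; proj₁)
  open import Relation.Binary.PropositionalEquality

  open Weights n M public

  D : ℕ
  D = N + t * E

  instance
    D-nonZero : NonZero D
    D-nonZero = >-nonZero (≤-trans (>-nonZero⁻¹ N {{m*n≢0 X M {{m^n≢0 (suc n) (suc n)}}}}) (m≤m+n N (t * E)))

  size : ℕ → ℕ
  size k = 1 + t * e k

  phase filler : ℕ → List ℚ
  phase  k = replicate (count k) (size k /ℕ D)
  filler k = replicate (N ∸ count k) (1 /ℕ D)

  phases phasesᴿ : ℕ → List ℚ
  phases  zero    = []
  phases  (suc k) = phases k ++ phase k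
  phasesᴿ zero    = []
  phasesᴿ (suc k) = phase k ++ phasesᴿ k

  σ : ℕ → List ℚ
  σ k = phases (suc k) ++ filler k

  optimum-fills : ∀ {k} → k ≤ suc n → (N ∸ count k) * 1 + count k * size k ≡ D
  optimum-fills {k} k≤1+n = begin-equality
    (N ∸ count k) * 1 + count k * (1 + t * e k)     ≡⟨ distrib (N ∸ count k) (count k) t (e k) ⟩
    (N ∸ count k) + count k + t * (count k * e k)   ≡⟨ cong₂ (λ u v → u + t * v) (m∸n+n≡m (count≤N k≤1+n)) (count*e≡E k≤1+n) ⟩
    N + t * E                                       ∎
    where
    open ≤-Reasoning
    distrib : ∀ r c t e → r * 1 + c * (1 + t * e) ≡ r + c + t * (c * e)
    distrib = solve-∀

  size≤D : ∀ {k} → k ≤ suc n → size k ≤ D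
  size≤D {k} k≤1+n = begin
    size k                                     ≤⟨ m≤n*m (size k) (count k) {{count≢0}} ⟩
    count k * size k                           ≤⟨ m≤n+m _ _ ⟩
    (N ∸ count k) * 1 + count k * size k       ≡⟨ optimum-fills k≤1+n ⟩
    D                                          ∎
    where
    open ≤-Reasoning
    count≢0 : NonZero (count k)
    count≢0 = m*n≢0 _ M {{m*n≢0 _ _ {{m^n≢0 n (suc n ∸ k)}} {{m^n≢0 (suc n) k}}}}

  item-ok : ∀ {s} → 0 < s → s ≤ D → Item-ok (s /ℕ D)
  item-ok {s} 0<s s≤D =
    subst (ℚ._< s /ℕ D) (0/D≡0 D) (/ℕ-mono-< D 0<s) , subst (s /ℕ D ℚ.≤_) (D/D≡1 D) (/ℕ-mono-≤ D s≤D)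

  valid-phases : ∀ {k} → k ≤ suc (suc n) → ValidInput (phases k)
  valid-phases {zero}  _      = []
  valid-phases {suc k} k<2+n =
    All.++⁺ (valid-phases (<⇒≤ k<2+n)) (All.replicate⁺ (count k) (item-ok z<s (size≤D (s≤s⁻¹ k<2+n))))

  valid-filler : ∀ k → ValidInput (filler k)
  valid-filler k = All.replicate⁺ (N ∸ count k) (item-ok z<s (>-nonZero⁻¹ D))

  valid-σ : ∀ {k} → k ≤ suc n → ValidInput (σ k)
  valid-σ {k} k≤1+n = All.++⁺ (valid-phases (s≤s k≤1+n)) (valid-filler k)

  phases↭phasesᴿ : ∀ k → phases k ↭ phasesᴿ k
  phases↭phasesᴿ zero    = ↭-refl
  phases↭phasesᴿ (suc k) = ↭-trans (++-comm (phases k) (phase k)) (++⁺ˡ (phase k) (phases↭phasesᴿ k))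

  phasesᴿ-↗ : ∀ {k} → k ≤ suc n → Sorted (size k /ℕ D ∷ phasesᴿ k)
  phasesᴿ-↗ {zero}  _      = Linked.[-]
  phasesᴿ-↗ {suc k} k<1+n =
    ↗-lower-head (/ℕ-mono-≤ D (s≤s (*-monoʳ-≤ t (e-antitone k<1+n)))) (replicate-↗ (count k) (phasesᴿ-↗ (<⇒≤ k<1+n)))

  sortℚ-σ : ∀ {k} → k ≤ suc n → sortℚ (σ k) ≡ filler k ++ phase k ++ phasesᴿ k
  sortℚ-σ {k} k≤1+n = sortℚ-unique sorted permutation
    where
    sorted : Sorted (filler k ++ phase k ++ phasesᴿ k)
    sorted = Linked.tail (replicate-↗ (N ∸ count k)
      (↗-lower-head (/ℕ-mono-≤ D (s≤s z≤n)) (replicate-↗ (count k) (phasesᴿ-↗ k≤1+n))))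
    permutation : σ k ↭ filler k ++ phase k ++ phasesᴿ k
    permutation = ↭-trans (++-comm (phases (suc k)) (filler k)) (++⁺ˡ (filler k) (phases↭phasesᴿ (suc k)))

  sumℚ-optimum : ∀ {k} → k ≤ suc n → sumℚ (filler k ++ phase k) ≡ ℚ.1ℚ
  sumℚ-optimum {k} k≤1+n = begin
    sumℚ (filler k ++ phase k)                            ≡⟨ sumℚ-++ (filler k) (phase k) ⟩
    sumℚ (filler k) ℚ.+ sumℚ (phase k)                    ≡⟨ cong₂ ℚ._+_ (sumℚ-replicate D (N ∸ count k) 1) (sumℚ-replicate D (count k) (size k)) ⟩
    ((N ∸ count k) * 1) /ℕ D ℚ.+ (count k * size k) /ℕ D  ≡⟨ /ℕ-homo-+ D _ _ ⟨
    ((N ∸ count k) * 1 + count k * size k) /ℕ D           ≡⟨ cong (_/ℕ D) (optimum-fills k≤1+n) ⟩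
    D /ℕ D                                                ≡⟨ D/D≡1 D ⟩
    ℚ.1ℚ                                                  ∎
    where open ≡-Reasoning

  optSol-σ : ∀ {k} → k ≤ suc n → optSol (σ k) ≡ filler k ++ phase k
  optSol-σ {k} k≤1+n = begin
    prefixFit ℚ.0ℚ (sortℚ (σ k))                                    ≡⟨ cong (prefixFit ℚ.0ℚ) (trans (sortℚ-σ k≤1+n) (sym (List.++-assoc (filler k) _ _))) ⟩
    prefixFit ℚ.0ℚ (optimum ++ phasesᴿ k)                            ≡⟨ prefixFit-++ (phasesᴿ k) (All.map (λ ok → ℚ.<⇒≤ (proj₁ ok)) valid-optimum) fits ⟩
    optimum ++ prefixFit (ℚ.0ℚ ℚ.+ sumℚ optimum) (phasesᴿ k)        ≡⟨ cong (λ l → optimum ++ prefixFit l (phasesᴿ k)) filled ⟩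
    optimum ++ prefixFit ℚ.1ℚ (phasesᴿ k)                            ≡⟨ cong (optimum ++_) (prefixFit-full (All.map proj₁ valid-rest)) ⟩
    optimum ++ []                                                    ≡⟨ List.++-identityʳ optimum ⟩
    optimum                                                          ∎
    where
    open ≡-Reasoning
    optimum : List ℚ
    optimum = filler k ++ phase k
    filled : ℚ.0ℚ ℚ.+ sumℚ optimum ≡ ℚ.1ℚ
    filled = trans (ℚ.+-identityˡ (sumℚ optimum)) (sumℚ-optimum k≤1+n)
    fits : ℚ.0ℚ ℚ.+ sumℚ optimum ℚ.≤ ℚ.1ℚ
    fits = ℚ.≤-reflexive filled
    valid-optimum : ValidInput optimum
    valid-optimum = All.++⁺ (valid-filler k) (All.++⁻ʳ (phases k) (valid-phases (s≤s k≤1+n)))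
    valid-rest : ValidInput (phasesᴿ k)
    valid-rest = All-resp-↭ (phases↭phasesᴿ k) (valid-phases (m≤n⇒m≤1+n k≤1+n))

  Opt-σ : ∀ {k} → k ≤ suc n → Opt (σ k) ≡ N
  Opt-σ {k} k≤1+n = begin-equality
    length (optSol (σ k))                   ≡⟨ cong length (optSol-σ k≤1+n) ⟩
    length (filler k ++ phase k)            ≡⟨ List.length-++ (filler k) ⟩
    length (filler k) + length (phase k)    ≡⟨ cong₂ _+_ (List.length-replicate (N ∸ count k)) (List.length-replicate (count k)) ⟩
    (N ∸ count k) + count k                 ≡⟨ m∸n+n≡m (count≤N k≤1+n) ⟩
    N                                       ∎
    where open ≤-Reasoning

  α : ℚ
  α = avg (σ 0)

  avg-σ : ∀ {k} → k ≤ suc n → avg (σ k) ≡ α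
  avg-σ {k} k≤1+n = avg-cong (σ k) (σ 0) (trans (Opt-σ k≤1+n) (sym (Opt-σ z≤n))) (begin
    sumℚ (optSol (σ k))          ≡⟨ cong sumℚ (optSol-σ k≤1+n) ⟩
    sumℚ (filler k ++ phase k)   ≡⟨ sumℚ-optimum k≤1+n ⟩
    ℚ.1ℚ                         ≡⟨ sumℚ-optimum z≤n ⟨
    sumℚ (filler 0 ++ phase 0)   ≡⟨ cong sumℚ (optSol-σ z≤n) ⟨
    sumℚ (optSol (σ 0))          ∎)
    where open ≡-Reasoning

  open Runs Alg α

  accepted : ℕ → ℕ
  accepted k = run Alg α (phases k) (loadAfter [] ℚ.0ℚ (phases k)) (phase k)

  run-phases : ∀ k → run Alg α [] ℚ.0ℚ (phases k) ≡ (∑[ j < k ] accepted j)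
  run-phases zero    = refl
  run-phases (suc k) = trans (run-++ [] ℚ.0ℚ (phases k) (phase k)) (cong (_+ accepted k) (run-phases k))

  loadAfter-phases : ∀ k → loadAfter [] ℚ.0ℚ (phases k) ≡ (∑[ j < k ] accepted j * size j) /ℕ D
  loadAfter-phases zero    = sym (0/D≡0 D)
  loadAfter-phases (suc k) = trans (loadAfter-++ [] ℚ.0ℚ (phases k) (phase k))
    (loadAfter-replicate (_/ℕ D) (/ℕ-homo-+ D) (phases k) (∑[ j < k ] accepted j * size j) (count k) (size k) (loadAfter-phases k))

  load-budget : ∀ k → (∑[ j < k ] accepted j * size j) ≤ D
  load-budget k = /ℕ-cancel-≤ D (subst₂ ℚ._≤_ (loadAfter-phases k) (sym (D/D≡1 D))
    (loadAfter-≤1 [] (phases k) (ℚ.nonNegative⁻¹ ℚ.1ℚ)))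

  profit-σ : ∀ {k} → k ≤ suc n → AlgProfit Alg (σ k) ≤ (∑[ j < suc k ] accepted j) + (N ∸ count k)
  profit-σ {k} k≤1+n = begin
    run Alg (avg (σ k)) [] ℚ.0ℚ (σ k)                                 ≡⟨ cong (λ adv → run Alg adv [] ℚ.0ℚ (σ k)) (avg-σ k≤1+n) ⟩
    run Alg α [] ℚ.0ℚ (phases (suc k) ++ filler k)                    ≡⟨ run-++ [] ℚ.0ℚ (phases (suc k)) (filler k) ⟩
    run Alg α [] ℚ.0ℚ (phases (suc k)) + run Alg α _ _ (filler k)     ≤⟨ +-mono-≤ (≤-reflexive (run-phases (suc k))) (run≤length _ _ (filler k)) ⟩
    (∑[ j < suc k ] accepted j) + length (filler k)                   ≡⟨ cong ((∑[ j < suc k ] accepted j) +_) (List.length-replicate (N ∸ count k)) ⟩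
    (∑[ j < suc k ] accepted j) + (N ∸ count k)                       ∎
    where open ≤-Reasoning

module LowerBound where

  open import Data.Nat
  open import Data.Nat.Properties
  open import Data.Nat.Tactic.RingSolver using (solve; solve-∀)
  open import Data.List using ([]; _∷_)
  open import Relation.Binary.PropositionalEquality
  open ≤-Reasoning

  budget-arithmetic : ∀ {p d b X Z N S} →
    suc d * d * b * X < N →
    p * N * X + d * (Z * N + Z * N) ≤ (d * N + d * b) * X + d * S →
    suc d * S ≤ N + suc d * (Z * N) →
    p * X + d * Z ≤ d * X
  budget-arithmetic {p} {d} {b} {X} {Z} {N} {S} slack weighted budget =
    s≤s⁻¹ (*-cancelˡ-< (suc d * N) _ _ (begin-strict
      suc d * N * (p * X + d * Z)                          ≤⟨ +-cancelʳ-≤ (suc d * d * (Z * N)) _ _ combined ⟩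
      suc d * N * (d * X) + (suc d * d * b * X + d * N)    <⟨ +-monoʳ-< (suc d * N * (d * X)) (+-monoˡ-< (d * N) slack) ⟩
      suc d * N * (d * X) + (N + d * N)                    ≡⟨ solve (d ∷ N ∷ X ∷ []) ⟩
      suc d * N * suc (d * X)                              ∎))
    where
    combined : suc d * N * (p * X + d * Z) + suc d * d * (Z * N)
               ≤ suc d * N * (d * X) + (suc d * d * b * X + d * N) + suc d * d * (Z * N)
    combined = begin
      suc d * N * (p * X + d * Z) + suc d * d * (Z * N)         ≡⟨ solve (p ∷ d ∷ X ∷ Z ∷ N ∷ []) ⟩
      suc d * (p * N * X + d * (Z * N + Z * N))                 ≤⟨ *-monoʳ-≤ (suc d) weighted ⟩
      suc d * ((d * N + d * b) * X + d * S)                     ≡⟨ solve (d ∷ b ∷ X ∷ N ∷ S ∷ []) ⟩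
      suc d * (d * N + d * b) * X + d * (suc d * S)             ≤⟨ +-monoʳ-≤ (suc d * (d * N + d * b) * X) (*-monoʳ-≤ d budget) ⟩
      suc d * (d * N + d * b) * X + d * (N + suc d * (Z * N))   ≡⟨ solve (d ∷ b ∷ X ∷ Z ∷ N ∷ []) ⟩
      suc d * N * (d * X) + (suc d * d * b * X + d * N) + suc d * d * (Z * N) ∎

  -- The adversary uses t = d + 1 and M = t·d·b + 1: then the unit parts of the item sizes and
  -- the additive constant b together cost less than N (slack, budget-arithmetic).
  module _ (n p d b : ℕ) where

    open Weights n (suc (suc d * d * b))

    ratio-bound : (a : ℕ → ℕ) →
      (∑[ j < suc (suc n) ] a j * (1 + suc d * e j)) ≤ N + suc d * E →
      (∀ {k} → k ≤ suc n → p * N ≤ d * ((∑[ j < suc k ] a j) + (N ∸ count k) + b)) →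
      p * X + d * Z ≤ d * X
    ratio-bound a budget competitive = budget-arithmetic {p} {d} {b} {X} {Z} {N} {S} slack weighted scaled-budget
      where
      A : ℕ → ℕ
      A k = ∑[ j < suc k ] a j
      S : ℕ
      S = ∑[ j < suc (suc n) ] a j * e j
      Y : ℕ
      Y = d * N + d * b

      slack : suc d * d * b * X < N
      slack = subst (_< N) (*-comm X _) (*-monoʳ-< X {{m^n≢0 (suc n) (suc n)}} (n<1+n _))

      phase-constraint : ∀ {k} → k ≤ suc n → p * N + d * count k ≤ Y + d * A k
      phase-constraint {k} k≤1+n = begin
        p * N + d * count k                                ≤⟨ +-monoˡ-≤ (d * count k) (competitive k≤1+n) ⟩
        d * (A k + (N ∸ count k) + b) + d * count k        ≡⟨ regroup d (A k) (N ∸ count k) b (count k) ⟩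
        d * ((N ∸ count k) + count k) + d * b + d * A k    ≡⟨ cong (λ x → d * x + d * b + d * A k) (m∸n+n≡m (count≤N k≤1+n)) ⟩
        Y + d * A k                                        ∎
        where
        regroup : ∀ d a r b c → d * (a + r + b) + d * c ≡ d * (r + c) + d * b + d * a
        regroup = solve-∀

      weighted : p * N * X + d * (E + E) ≤ Y * X + d * S
      weighted = begin
        p * N * X + d * (E + E)          ≡⟨ cong₂ (λ x y → p * N * x + d * y) e-0 W-count ⟨
        p * N * e 0 + d * W count        ≡⟨ W-affine (p * N) d count ⟨
        W (λ k → p * N + d * count k)    ≤⟨ W-mono-≤ phase-constraint ⟩
        W (λ k → Y + d * A k)            ≡⟨ W-affine Y d A ⟩
        Y * e 0 + d * W A                ≡⟨ cong₂ (λ x y → Y * x + d * y) e-0 (W-prefix-sums a) ⟩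
        Y * X + d * S                    ∎

      scaled-budget : suc d * S ≤ N + suc d * E
      scaled-budget = begin
        suc d * S                                               ≤⟨ m≤n+m (suc d * S) (A (suc n)) ⟩
        A (suc n) + suc d * S                                   ≡⟨ split ⟨
        (∑[ j < suc (suc n) ] a j * (1 + suc d * e j))          ≤⟨ budget ⟩
        N + suc d * E                                           ∎
        where
        distrib : ∀ x t y → x * (1 + t * y) ≡ x + t * (x * y)
        distrib = solve-∀
        split : (∑[ j < suc (suc n) ] a j * (1 + suc d * e j)) ≡ A (suc n) + suc d * S
        split = begin-equality
          (∑[ j < suc (suc n) ] a j * (1 + suc d * e j))        ≡⟨ ∑-cong {suc (suc n)} (λ {j} _ → distrib (a j) (suc d) (e j)) ⟩
          (∑[ j < suc (suc n) ] a j + suc d * (a j * e j))      ≡⟨ ∑-distrib-+ (suc (suc n)) a _ ⟩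
          A (suc n) + (∑[ j < suc (suc n) ] suc d * (a j * e j)) ≡⟨ cong (A (suc n) +_) (*-distribˡ-∑ (suc d) (suc (suc n)) _) ⟨
          A (suc n) + suc d * S                                 ∎

  adversary-bound : ∀ (A : OnlineAlg) n .{{_ : NonZero n}} p d b →
    (∀ σ → ValidInput σ → p * Opt σ ≤ d * (AlgProfit A σ + b)) →
    p * suc n ^ suc n + d * n ^ suc n ≤ d * suc n ^ suc n
  adversary-bound A n p d b competitive = ratio-bound n p d b accepted (load-budget (suc (suc n))) per-phase
    where
    open Adversary A n (suc d) (suc (suc d * d * b))
    per-phase : ∀ {k} → k ≤ suc n → p * N ≤ d * ((∑[ j < suc k ] accepted j) + (N ∸ count k) + b)
    per-phase {k} k≤1+n = begin
      p * N                            ≡⟨ cong (p *_) (Opt-σ k≤1+n) ⟨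
      p * Opt (σ k)                    ≤⟨ competitive (σ k) (valid-σ k≤1+n) ⟩
      d * (AlgProfit A (σ k) + b)      ≤⟨ *-monoʳ-≤ d (+-monoˡ-≤ b (profit-σ k≤1+n)) ⟩
      d * ((∑[ j < suc k ] accepted j) + (N ∸ count k) + b) ∎

open LowerBound using (adversary-bound)

module Conversions where

  open import Data.Nat as ℕ using (suc; NonZero)
  import Data.Nat.Properties as ℕ
  open import Data.Integer as ℤ using (+_; -[1+_])
  import Data.Integer.Properties as ℤ
  open import Data.Rational using (ℚ; mkℚ; 0ℚ; 1ℚ; _+_; _-_; -_; _*_; _/_; _≤_)
  open import Data.Rational.Properties
  import Data.Rational.Unnormalised as ℚᵘ
  import Data.Rational.Unnormalised.Properties as ℚᵘ
  open import Data.Rational.Solver using (module +-*-Solver)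
  open import Relation.Binary.PropositionalEquality
  open +-*-Solver

  numerator⁺ : ℚ → ℕ
  numerator⁺ (mkℚ (+ k)    _ _) = k
  numerator⁺ (mkℚ -[1+ _ ] _ _) = 0

  ≤numerator⁺ : ∀ q → q ≤ toℚ (numerator⁺ q)
  ≤numerator⁺ (mkℚ (+ k) d-1 _) = toℚᵘ-cancel-≤ (ℚᵘ.≤-respʳ-≃ (ℚᵘ.≃-sym (toℚᵘ-fromℚᵘ (ℚᵘ.mkℚᵘ (+ k) 0)))
    (ℚᵘ.*≤* (subst₂ ℤ._≤_ (ℤ.pos-* k 1) (ℤ.pos-* k (suc d-1)) (ℤ.+≤+ (ℕ.*-monoʳ-≤ k (ℕ.s≤s ℕ.z≤n))))))
  ≤numerator⁺ q@(mkℚ -[1+ _ ] _ _) = nonPositive⁻¹ q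

  competitive-in-ℕ : ∀ {c p d b} x y → c * toℚ d ≡ toℚ p → c * toℚ x - b ≤ toℚ y →
    p ℕ.* x ℕ.≤ d ℕ.* (y ℕ.+ numerator⁺ b)
  competitive-in-ℕ {c} {p} {d} {b} x y c*d≡p cx-b≤y = toℚ-cancel-≤ {p ℕ.* x} (begin
    toℚ (p ℕ.* x)                           ≡⟨ toℚ-homo-* p x ⟩
    toℚ p * toℚ x                           ≡⟨ cong (_* toℚ x) c*d≡p ⟨
    c * toℚ d * toℚ x                       ≡⟨ swap c (toℚ d) (toℚ x) ⟩
    c * toℚ x * toℚ d                       ≤⟨ *-monoʳ-≤-nonNeg (toℚ d) {{normalize-nonNeg d 1}} cx≤y+b ⟩
    toℚ (y ℕ.+ numerator⁺ b) * toℚ d        ≡⟨ *-comm (toℚ (y ℕ.+ numerator⁺ b)) (toℚ d) ⟩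
    toℚ d * toℚ (y ℕ.+ numerator⁺ b)        ≡⟨ toℚ-homo-* d (y ℕ.+ numerator⁺ b) ⟨
    toℚ (d ℕ.* (y ℕ.+ numerator⁺ b))        ∎)
    where
    open ≤-Reasoning
    swap : ∀ u v w → u * v * w ≡ u * w * v
    swap = solve 3 (λ u v w → u :* v :* w := u :* w :* v) refl
    cx≤y+b : c * toℚ x ≤ toℚ (y ℕ.+ numerator⁺ b)
    cx≤y+b = begin
      c * toℚ x                      ≡⟨ solve 2 (λ u v → u := u :- v :+ v) refl (c * toℚ x) b ⟩
      c * toℚ x - b + b              ≤⟨ +-mono-≤ cx-b≤y (≤numerator⁺ b) ⟩
      toℚ y + toℚ (numerator⁺ b)     ≡⟨ toℚ-homo-+ y (numerator⁺ b) ⟨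
      toℚ (y ℕ.+ numerator⁺ b)       ∎

  bound-from-ℕ : ∀ n {c p d} .{{_ : NonZero d}} → c * toℚ d ≡ toℚ p →
    p ℕ.* suc n ℕ.^ suc n ℕ.+ d ℕ.* n ℕ.^ suc n ℕ.≤ d ℕ.* suc n ℕ.^ suc n →
    c ≤ 1ℚ - (+ n / suc n) ^ℚ suc n
  bound-from-ℕ n {c} {p} {d} c*d≡p ineq = begin
    c              ≡⟨ solve 2 (λ u v → u := u :+ v :- v) refl c q ⟩
    c + q - q      ≤⟨ +-monoˡ-≤ (- q) c+q≤1 ⟩
    1ℚ - q         ∎
    where
    open ≤-Reasoning
    X Z : ℕ
    X = suc n ℕ.^ suc n
    Z = n ℕ.^ suc n
    q : ℚ
    q = (+ n / suc n) ^ℚ suc n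
    q*X≡Z : q * toℚ X ≡ toℚ Z
    q*X≡Z = subst (λ r → r ^ℚ suc n * toℚ X ≡ toℚ Z) (/ℕ≡/ n (suc n)) ([a/D]^k*D^k≡a^k (suc n) n (suc n))
    instance
      X≢0 : NonZero X
      X≢0 = ℕ.m^n≢0 (suc n) (suc n)
      dX≢0 : NonZero (d ℕ.* X)
      dX≢0 = ℕ.m*n≢0 d X
    expand : ∀ u v w y → (u + v) * (w * y) ≡ u * w * y + w * (v * y)
    expand = solve 4 (λ u v w y → (u :+ v) :* (w :* y) := u :* w :* y :+ w :* (v :* y)) refl
    c+q≤1 : c + q ≤ 1ℚ
    c+q≤1 = *-cancelʳ-≤-pos (toℚ (d ℕ.* X)) {{normalize-pos (d ℕ.* X) 1}} (begin
      (c + q) * toℚ (d ℕ.* X)           ≡⟨ cong ((c + q) *_) (toℚ-homo-* d X) ⟩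
      (c + q) * (toℚ d * toℚ X)         ≡⟨ expand c q (toℚ d) (toℚ X) ⟩
      c * toℚ d * toℚ X + toℚ d * (q * toℚ X)
        ≡⟨ cong₂ (λ u v → u * toℚ X + toℚ d * v) c*d≡p q*X≡Z ⟩
      toℚ p * toℚ X + toℚ d * toℚ Z     ≡⟨ cong₂ _+_ (toℚ-homo-* p X) (toℚ-homo-* d Z) ⟨
      toℚ (p ℕ.* X) + toℚ (d ℕ.* Z)     ≡⟨ toℚ-homo-+ (p ℕ.* X) (d ℕ.* Z) ⟨
      toℚ (p ℕ.* X ℕ.+ d ℕ.* Z)         ≤⟨ toℚ-mono-≤ ineq ⟩
      toℚ (d ℕ.* X)                     ≡⟨ *-identityˡ (toℚ (d ℕ.* X)) ⟨
      1ℚ * toℚ (d ℕ.* X)                ∎)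

  0≤bound : ∀ n → 0ℚ ≤ 1ℚ - (+ n / suc n) ^ℚ suc n
  0≤bound n = bound-from-ℕ n {p = 0} {d = 1} (*-zeroˡ (toℚ 1))
    (ℕ.+-monoˡ-≤ 0 (ℕ.^-monoˡ-≤ (suc n) (ℕ.n≤1+n n)))

open Conversions

open import Data.Nat using (_+_; _*_; _≤_)
open import Data.Integer using (+_; -[1+_])
open import Data.Rational as ℚ using (mkℚ)
import Data.Rational.Properties as ℚ
open import Data.Product using (_,_)
open import Relation.Binary.PropositionalEquality using (_≡_; subst; trans)

theorem4 : (A : OnlineAlg) (c : ℚ) → Competitive A c → ≤1-1/e c
theorem4 A c@(mkℚ -[1+ _ ] _ _) _ m = ℚ.≤-trans (ℚ.nonPositive⁻¹ c) (0≤bound (suc m))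
theorem4 A c@(mkℚ (+ p) d-1 coprime) (b , competitive) m =
  bound-from-ℕ (suc m) {c} {p} {d} c*d≡p (adversary-bound A (suc m) p d (numerator⁺ b) competitive-ℕ)
  where
  d : ℕ
  d = suc d-1
  c*d≡p : c ℚ.* toℚ d ≡ toℚ p
  c*d≡p = subst (λ c → c ℚ.* toℚ d ≡ toℚ p) (trans (/ℕ≡/ p d) (ℚ.normalize-coprime coprime)) (a/D*D≡a d p)
  competitive-ℕ : ∀ σ → ValidInput σ → p * Opt σ ≤ d * (AlgProfit A σ + numerator⁺ b)
  competitive-ℕ σ valid = competitive-in-ℕ {c} {p} {d} {b} (Opt σ) (AlgProfit A σ) c*d≡p (competitive σ valid)
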